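{- Let $M$ and $N$ be positroids on $[n]$ such that $M$ is a quotient of $N$. Let $I^{\sigma},I^{\pi}$ be the Grassmann necklaces of $M$ and $N$, and $J^{\sigma},J^{\pi}$ their Grassmann conecklaces, respectively. Then $I^{\sigma}_i\subseteq I^{\pi}_i$ and $J^{\sigma}_i\subseteq J^{\pi}_i$ for all $i\in[n]$.
   Context: For $i\in[n]$ the cyclic order $<_i$ is $i<_i i+1<_i\cdots<_i n<_i 1<_i\cdots<_i i-1$; $A\leq_i B$ (Gale order, equal-size sets) means the $t$-th smallest element of $A$ under $<_i$ is $\leq_i$ the $t$-th smallest element of $B$, for all $t$. A positroid is a matroid on $[n]$ whose set of bases equals $\{B: I_i\leq_i B\ \forall i\}$ for a Grassmann necklace $(I_1,\dots,I_n)$; its Grassmann necklace consists of the $\leq_i$-minimum bases $I_i$, and its Grassmann conecklace of the $\leq_i$-maximum bases $J_i$. $M$ is a quotient of $N$ if every circuit of $N$ is a union of circuits of $M$. -}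

module Defs where

open import Data.Nat using (ℕ; suc; _≤_; _∸_; _+_; _<?_)
open import Data.Bool using (if_then_else_)
open import Data.Fin using (Fin; toℕ; zero; fromℕ<)
open import Data.Fin.Subset using (Subset; _∈_; _∉_; _⊆_; ∣_∣; ⁅_⁆; _∪_; _─_)
open import Data.Fin.Subset.Properties using (_∈?_)
open import Data.List using (List; filter; allFin; drop; take; _++_)
open import Data.List.Relation.Binary.Pointwise using (Pointwise)
open import Data.Product using (Σ; ∃; _×_)
open import Relation.Binary.PropositionalEquality using (_≡_)
open import Relation.Nullary using (¬_; does; yes; no)
open import Data.Nat using (_≤ᵇ_)

record Matroid (n : ℕ) : Set₁ where
  field
    IsBasis  : Subset n → Set
    nonempty : ∃ λ B → IsBasis B
    exchange : ∀ {B₁ B₂ x} → IsBasis B₁ → IsBasis B₂ → x ∈ B₁ → x ∉ B₂ →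
               ∃ λ y → (y ∈ B₂) × (y ∉ B₁) × IsBasis ((B₁ ─ ⁅ x ⁆) ∪ ⁅ y ⁆)

module _ {n : ℕ} (M : Matroid n) where
  open Matroid M

  Independent : Subset n → Set
  Independent X = ∃ λ B → IsBasis B × X ⊆ B

  Circuit : Subset n → Set
  Circuit C = ¬ Independent C × (∀ x → x ∈ C → Independent (C ─ ⁅ x ⁆))

-- M is a quotient of N: every circuit of N is a union of circuits of M.
_IsQuotientOf_ : ∀ {n} → Matroid n → Matroid n → Set
M IsQuotientOf N = ∀ C → Circuit N C →
  (∀ x → x ∈ C → ∃ λ C' → Circuit M C' × C' ⊆ C × x ∈ C')

-- position of a in the cyclic order <_i  (i ↦ 0, i+1 ↦ 1, …, i-1 ↦ n-1)
rank : ∀ {n} → Fin n → Fin n → ℕ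
rank {n} i a = if toℕ i ≤ᵇ toℕ a then toℕ a ∸ toℕ i else toℕ a + n ∸ toℕ i

_≤[_]_ : ∀ {n} → Fin n → Fin n → Fin n → Set
a ≤[ i ] b = rank i a ≤ rank i b

cyclicOrder : ∀ {n} → Fin n → List (Fin n)
cyclicOrder {n} i = drop (toℕ i) (allFin n) ++ take (toℕ i) (allFin n)

sortedᵢ : ∀ {n} → Fin n → Subset n → List (Fin n)
sortedᵢ i A = filter (λ x → x ∈? A) (cyclicOrder i)

-- Gale order A ≤_i B (t-th smallest of A ≤_i t-th smallest of B for all t;
-- Pointwise also forces |A| = |B|)
Gale : ∀ {n} → Fin n → Subset n → Subset n → Set
Gale i A B = Pointwise (λ a b → a ≤[ i ] b) (sortedᵢ i A) (sortedᵢ i B)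

next : ∀ {n} → Fin n → Fin n
next {suc m} i with suc (toℕ i) <? suc m
... | yes p = fromℕ< p
... | no _  = zero

IsGrassmannNecklace : ∀ {n} → (Fin n → Subset n) → Set
IsGrassmannNecklace {n} I =
  Σ ℕ λ k → (∀ i → ∣ I i ∣ ≡ k) × (∀ i → (I i ─ ⁅ i ⁆) ⊆ I (next i))

IsPositroid : ∀ {n} → Matroid n → Set
IsPositroid {n} M = ∃ λ (I : Fin n → Subset n) → IsGrassmannNecklace I ×
  (∀ B → (Matroid.IsBasis M B → ∀ i → Gale i (I i) B)
       × ((∀ i → Gale i (I i) B) → Matroid.IsBasis M B))

IsNecklaceEntry : ∀ {n} → Matroid n → Fin n → Subset n → Set
IsNecklaceEntry M i A = Matroid.IsBasis M A × (∀ B → Matroid.IsBasis M B → Gale i A B)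

IsConecklaceEntry : ∀ {n} → Matroid n → Fin n → Subset n → Set
IsConecklaceEntry M i A = Matroid.IsBasis M A × (∀ B → Matroid.IsBasis M B → Gale i B A)

-- Order the ground set by a ranking κ (the cyclic order <ᵢ, or its reverse) and call a
-- basis minimal if, for every threshold t, no basis has more elements of rank below t;
-- necklace entries are minimal for <ᵢ and conecklace entries for its reverse. Let A, B be
-- minimal bases of M and N and suppose x ∈ A ∖ B. Minimality of B makes the elements of B
-- below x, together with x, dependent in N, so they contain an N-circuit through x; as M is
-- a quotient of N, that circuit contains an M-circuit C through x whose other elements all
-- lie below x. Exchanging x out of A into C yields a basis A - x + y with y below x, which
-- beats A at threshold κ x.

module Submission where

open import Defs
open import Data.Nat using (ℕ)
open import Data.Fin using (Fin)
open import Data.Fin.Subset using (Subset; _⊆_)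
open import Data.Product using (_×_)

open import Data.Bool using (true; false)
open import Data.Fin using (toℕ; _≟_)
open import Data.Fin.Properties using (toℕ<n; toℕ-injective; any?; all?)
open import Data.Fin.Subset using (_∈_; _∉_; ⁅_⁆; _∪_; _∩_; _─_; _-_; _⊂_; inside; outside)
open import Data.Fin.Subset.Induction using (Acc; acc; ⊂-wellFounded)
open import Data.Fin.Subset.Properties
  using (_∈?_; _⊆?_; anySubset?; x∈p∩q⁺; x∈p∩q⁻; x∈p∪q⁺; x∈p∪q⁻; x∈⁅x⁆; x∈⁅y⁆⇒x≡y;
         x∈p∧x∉q⇒x∈p─q; x∈p∧x≢y⇒x∈p-y; p─q⊆p; x∈p⇒p-x⊂p)
open import Data.List using (List; []; _∷_; filter; length; take; drop; allFin)
open import Data.List.Membership.Propositional using () renaming (_∈_ to _∈ₗ_)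
open import Data.List.Membership.Propositional.Properties
  using (∈-allFin; ∈-++⁺ˡ; ∈-++⁺ʳ; ∈-++⁻)
open import Data.List.Properties using (take++drop≡id)
open import Data.List.Relation.Binary.Pointwise using (Pointwise)
open import Data.List.Relation.Binary.Pointwise.Properties using (decidable; symmetric)
open import Data.List.Relation.Binary.Sublist.Heterogeneous.Properties
  using (length-mono-≤; ⊆-filter-Sublist; fromPointwise)
open import Data.List.Relation.Binary.Sublist.Propositional using (⊆-refl)
open import Data.List.Relation.Unary.Any using (here; there)
open import Data.Nat using (suc; _≤_; _<_; _<?_; _∸_; _+_; _≤ᵇ_; s≤s)
open import Data.Nat.DivMod using (_%_; m<n⇒m%n≡m; [m+n]%n≡m%n)
import Data.Nat.Properties as ℕ
open import Data.Product using (∃; _,_; proj₁; proj₂)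
open import Data.Sum using (_⊎_; inj₁; inj₂)
open import Data.Vec using (tabulate; _∷_; here; there)
open import Data.Vec.Properties using (lookup∘tabulate; []=⇒lookup; lookup⇒[]=)
open import Function using (_∘_; id)
open import Function.Definitions using (Injective)
open import Relation.Binary.Core using (REL)
open import Relation.Binary.PropositionalEquality
  using (_≡_; _≢_; refl; sym; trans; cong; subst; module ≡-Reasoning)
open import Relation.Nullary using (¬_; Dec; yes; no; does; contradiction; ¬?)
open import Relation.Nullary.Decidable using (_×-dec_; map′; dec-true; decidable-stable)
open import Relation.Nullary.Reflects using (ofʸ; ofⁿ)
open import Relation.Unary using (Pred; Decidable)
open import Relation.Unary.Properties using (_∩?_)

module _ {a p q} {A : Set a} {P : Pred A p} {Q : Pred A q}
         (P? : Decidable P) (Q? : Decidable Q) where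

  filter-filter : ∀ xs → filter Q? (filter P? xs) ≡ filter (P? ∩? Q?) xs
  filter-filter [] = refl
  filter-filter (x ∷ xs) with P? x
  ... | no _ = filter-filter xs
  ... | yes _ with Q? x
  ...   | yes _ = cong (x ∷_) (filter-filter xs)
  ...   | no _  = filter-filter xs

  Pointwise⇒length-filter-≤ : ∀ {r} {R : REL A A r} → (∀ {x y} → R x y → P x → Q y) →
    ∀ {xs ys} → Pointwise R xs ys → length (filter P? xs) ≤ length (filter Q? ys)
  Pointwise⇒length-filter-≤ P⇒Q rs =
    length-mono-≤ (⊆-filter-Sublist P? Q? P⇒Q (fromPointwise rs))

  length-filter-mono : (∀ {x} → P x → Q x) → ∀ xs → length (filter P? xs) ≤ length (filter Q? xs)
  length-filter-mono P⇒Q xs =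
    length-mono-≤ (⊆-filter-Sublist P? Q? (λ { refl → P⇒Q }) (⊆-refl {x = xs}))

  length-filter-mono-< : (∀ {x} → P x → Q x) → ∀ {y xs} → y ∈ₗ xs → Q y → ¬ P y →
    length (filter P? xs) < length (filter Q? xs)
  length-filter-mono-< P⇒Q {y} {_ ∷ xs} (here refl) qy ¬py with P? y
  ... | yes py = contradiction py ¬py
  ... | no _ with Q? y
  ...   | yes _  = s≤s (length-filter-mono P⇒Q xs)
  ...   | no ¬qy = contradiction qy ¬qy
  length-filter-mono-< P⇒Q {xs = x ∷ _} (there y∈xs) qy ¬py with P? x | Q? x
  ... | yes _  | yes _  = s≤s (length-filter-mono-< P⇒Q y∈xs qy ¬py)
  ... | yes px | no ¬qx = contradiction (P⇒Q px) ¬qx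
  ... | no _   | yes _  = ℕ.m<n⇒m<1+n (length-filter-mono-< P⇒Q y∈xs qy ¬py)
  ... | no _   | no _   = length-filter-mono-< P⇒Q y∈xs qy ¬py

x∈p─q⇒x∉q : ∀ {n} {x : Fin n} (p q : Subset n) → x ∈ p ─ q → x ∉ q
x∈p─q⇒x∉q {x = Fin.zero}  (_ ∷ _) (outside ∷ _) _ ()
x∈p─q⇒x∉q {x = Fin.zero}  (_ ∷ _) (inside ∷ _)  ()
x∈p─q⇒x∉q {x = Fin.suc x} (_ ∷ p) (_ ∷ q) (there x∈p─q) (there x∈q) = x∈p─q⇒x∉q p q x∈p─q x∈q

module _ {n : ℕ} where

  p-x⊆q∧x∈q⇒p⊆q : ∀ {p q : Subset n} {x} → p - x ⊆ q → x ∈ q → p ⊆ q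
  p-x⊆q∧x∈q⇒p⊆q {x = x} p-x⊆q x∈q {y} y∈p with y ≟ x
  ... | yes refl = x∈q
  ... | no y≢x   = p-x⊆q (x∈p∧x≢y⇒x∈p-y y∈p y≢x)

  ⊆-swap : ∀ {p q : Subset n} {y z} → p ⊆ q → y ∉ p → p ⊆ (q - y) ∪ ⁅ z ⁆
  ⊆-swap {y = y} p⊆q y∉p {x} x∈p = x∈p∪q⁺ (inj₁ (x∈p∧x≢y⇒x∈p-y (p⊆q x∈p) λ { refl → y∉p x∈p }))

  ─-swap-⊂ : ∀ {p q : Subset n} {y z} → z ∈ p → z ∉ q → y ∉ p → p ─ ((q - y) ∪ ⁅ z ⁆) ⊂ p ─ q
  ─-swap-⊂ {p} {q} {y} {z} z∈p z∉q y∉p = shrink , z , x∈p∧x∉q⇒x∈p─q z∈p z∉q , z-removed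
    where
    q' = (q - y) ∪ ⁅ z ⁆
    z-removed : z ∉ p ─ q'
    z-removed m = x∈p─q⇒x∉q p q' m (x∈p∪q⁺ (inj₂ (x∈⁅x⁆ z)))
    shrink : p ─ q' ⊆ p ─ q
    shrink {x} m = x∈p∧x∉q⇒x∈p─q x∈p x∉q
      where
      x∈p = p─q⊆p p q' m
      x∉q : x ∉ q
      x∉q x∈q with x ≟ y
      ... | yes refl = y∉p x∈p
      ... | no x≢y   = x∈p─q⇒x∉q p q' m (x∈p∪q⁺ (inj₁ (x∈p∧x≢y⇒x∈p-y x∈q x≢y)))

  ⟦_⟧ : ∀ {ℓ} {P : Pred (Fin n) ℓ} → Decidable P → Subset n
  ⟦ P? ⟧ = tabulate (does ∘ P?)

  ∈⟦⟧⁺ : ∀ {ℓ} {P : Pred (Fin n) ℓ} (P? : Decidable P) {x} → P x → x ∈ ⟦ P? ⟧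
  ∈⟦⟧⁺ P? {x} px = lookup⇒[]= x _ (trans (lookup∘tabulate _ x) (dec-true (P? x) px))

  ∈⟦⟧⁻ : ∀ {ℓ} {P : Pred (Fin n) ℓ} (P? : Decidable P) {x} → x ∈ ⟦ P? ⟧ → P x
  ∈⟦⟧⁻ P? {x} m with P? x | trans (sym (lookup∘tabulate _ x)) ([]=⇒lookup m)
  ... | yes px | _ = px
  ... | no _   | ()

module MatroidProperties {n : ℕ} (M : Matroid n) where
  open Matroid M

  Independent-⊆ : ∀ {X Y} → X ⊆ Y → Independent M Y → Independent M X
  Independent-⊆ X⊆Y (B , bB , Y⊆B) = B , bB , Y⊆B ∘ X⊆Y

  -- Start from a basis B ⊇ C - x. Exchanging x out of A into B gives y; if y ∉ C, exchange
  -- y out of B for an element of A, which keeps C - x ⊆ B and shrinks A ─ B.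
  basis-exchange-into-circuit : ∀ {A C x} → IsBasis A → x ∈ A → Circuit M C → x ∈ C →
    ∃ λ y → y ∈ C × y ∉ A × IsBasis ((A - x) ∪ ⁅ y ⁆)
  basis-exchange-into-circuit {A} {C} {x} bA x∈A (dependent , minimal) x∈C
    with minimal x x∈C
  ... | B₀ , bB₀ , C-x⊆B₀ = go bB₀ C-x⊆B₀ (⊂-wellFounded (A ─ B₀))
    where
    go : ∀ {B} → IsBasis B → C - x ⊆ B → Acc _⊂_ (A ─ B) →
         ∃ λ y → y ∈ C × y ∉ A × IsBasis ((A - x) ∪ ⁅ y ⁆)
    go {B} bB C-x⊆B (acc smaller) with exchange bA bB x∈A x∉B
      where
      x∉B : x ∉ B
      x∉B x∈B = dependent (B , bB , p-x⊆q∧x∈q⇒p⊆q C-x⊆B x∈B)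
    ... | y , y∈B , y∉A , bA-x+y with y ∈? C
    ...   | yes y∈C = y , y∈C , y∉A , bA-x+y
    ...   | no y∉C with exchange bB bA y∈B y∉A
    ...     | z , z∈A , z∉B , bB-y+z =
      go bB-y+z (⊆-swap C-x⊆B (y∉C ∘ p─q⊆p C ⁅ x ⁆)) (smaller (─-swap-⊂ z∈A z∉B y∉A))

  module _ (independent? : Decidable (Independent M)) where

    dependent⇒⊇circuit : ∀ {X} → ¬ Independent M X → ∃ λ C → Circuit M C × C ⊆ X
    dependent⇒⊇circuit {X} = go (⊂-wellFounded X)
      where
      go : ∀ {X} → Acc _⊂_ X → ¬ Independent M X → ∃ λ C → Circuit M C × C ⊆ X
      go {X} (acc smaller) dependent
        with any? (λ z → z ∈? X ×-dec ¬? (independent? (X - z)))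
      ... | yes (z , z∈X , X-z-dependent) with go (smaller (x∈p⇒p-x⊂p z∈X)) X-z-dependent
      ...   | C , circuit , C⊆X-z = C , circuit , p─q⊆p X ⁅ z ⁆ ∘ C⊆X-z
      go {X} (acc _) dependent | no no-removable = X , (dependent , minimal) , id
        where
        minimal : ∀ z → z ∈ X → Independent M (X - z)
        minimal z z∈X = decidable-stable (independent? (X - z)) (λ X-z-dependent →
          no-removable (z , z∈X , X-z-dependent))

positroid⇒independent? : ∀ {n} (M : Matroid n) → IsPositroid M → Decidable (Independent M)
positroid⇒independent? M (I , _ , bases) X = anySubset? (λ B → basis? B ×-dec X ⊆? B)
  where
  gale? : ∀ i A B → Dec (Gale i A B)
  gale? i A B = decidable (λ a b → rank i a ℕ.≤? rank i b) (sortedᵢ i A) (sortedᵢ i B)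
  basis? : Decidable (Matroid.IsBasis M)
  basis? B = map′ (proj₂ (bases B)) (proj₁ (bases B)) (all? (λ i → gale? i (I i) B))

module MinimalBases {n : ℕ} (κ : Fin n → ℕ) (κ-injective : Injective _≡_ _≡_ κ)
                   (xs : List (Fin n)) (xs-complete : ∀ y → y ∈ₗ xs) where

  -- Counted along xs so that, for xs = cyclicOrder i, this filters the list sortedᵢ i X
  -- that Gale compares.
  count : ℕ → Subset n → ℕ
  count t X = length (filter (λ y → κ y <? t) (filter (_∈? X) xs))

  private
    count≡ : ∀ t X → count t X ≡ length (filter ((_∈? X) ∩? (λ y → κ y <? t)) xs)
    count≡ t X = cong length (filter-filter (_∈? X) (λ y → κ y <? t) xs)

  count-mono-< : ∀ {t X Y y} → (∀ {y} → y ∈ X → κ y < t → y ∈ Y) →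
    y ∈ Y → κ y < t → y ∉ X → count t X < count t Y
  count-mono-< {t} {X} {Y} {y} X⊆Y y∈Y y<t y∉X = begin-strict
    count t X ≡⟨ count≡ t X ⟩
    _         <⟨ length-filter-mono-< _ _ (λ (y∈X , y<t) → X⊆Y y∈X y<t , y<t)
                   (xs-complete y) (y∈Y , y<t) (y∉X ∘ proj₁) ⟩
    _         ≡⟨ count≡ t Y ⟨
    count t Y ∎
    where open ℕ.≤-Reasoning

  IsMinimalBasis : Matroid n → Subset n → Set
  IsMinimalBasis M A =
    Matroid.IsBasis M A × (∀ B → Matroid.IsBasis M B → ∀ t → count t B ≤ count t A)

  minimal-basis-no-descent : ∀ M {A x y} → IsMinimalBasis M A → x ∈ A → y ∉ A → κ y < κ x →
    ¬ Matroid.IsBasis M ((A - x) ∪ ⁅ y ⁆)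
  minimal-basis-no-descent M {A} {x} {y} (_ , minimal) x∈A y∉A y<x bA' =
    ℕ.<⇒≱ (count-mono-< keep (x∈p∪q⁺ (inj₂ (x∈⁅x⁆ y))) y<x y∉A) (minimal _ bA' (κ x))
    where
    keep : ∀ {z} → z ∈ A → κ z < κ x → z ∈ (A - x) ∪ ⁅ y ⁆
    keep z∈A z<x = x∈p∪q⁺ (inj₁ (x∈p∧x≢y⇒x∈p-y z∈A λ { refl → ℕ.<-irrefl refl z<x }))

  below : Fin n → Subset n
  below x = ⟦ (λ y → κ y <? κ x) ⟧

  minimal-basis-lower-part-dependent : ∀ N {B x} → IsMinimalBasis N B → x ∉ B →
    ¬ Independent N ((B ∩ below x) ∪ ⁅ x ⁆)
  minimal-basis-lower-part-dependent N {B} {x} (_ , minimal) x∉B (B' , bB' , S⊆B') =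
    ℕ.<⇒≱ (count-mono-< keep (S⊆B' (x∈p∪q⁺ (inj₂ (x∈⁅x⁆ x)))) (ℕ.n<1+n (κ x)) x∉B)
          (minimal B' bB' (suc (κ x)))
    where
    keep : ∀ {z} → z ∈ B → κ z < suc (κ x) → z ∈ B'
    keep {z} z∈B z≤x with κ z <? κ x
    ... | yes z<x = S⊆B' (x∈p∪q⁺ (inj₁ (x∈p∩q⁺ (z∈B , ∈⟦⟧⁺ (λ y → κ y <? κ x) z<x))))
    ... | no z≮x  = contradiction (subst (_∈ B) z≡x z∈B) x∉B
      where z≡x = κ-injective (ℕ.≤-antisym (ℕ.≤-pred z≤x) (ℕ.≮⇒≥ z≮x))

  ∈-lower-part⁻ : ∀ {B x y} → y ∈ (B ∩ below x) ∪ ⁅ x ⁆ → (y ∈ B × κ y < κ x) ⊎ y ≡ x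
  ∈-lower-part⁻ {B} {x} {y} m with x∈p∪q⁻ (B ∩ below x) ⁅ x ⁆ m
  ... | inj₁ y∈B∩below = let y∈B , y∈below = x∈p∩q⁻ B (below x) y∈B∩below
                         in inj₁ (y∈B , ∈⟦⟧⁻ (λ y → κ y <? κ x) y∈below)
  ... | inj₂ y∈⁅x⁆     = inj₂ (x∈⁅y⁆⇒x≡y x y∈⁅x⁆)

  quotient-circuit-below : ∀ M N {B x} → M IsQuotientOf N → Decidable (Independent N) →
    IsMinimalBasis N B → x ∉ B →
    ∃ λ C → Circuit M C × x ∈ C × (∀ {y} → y ∈ C → y ≢ x → κ y < κ x)
  quotient-circuit-below M N {B} {x} quotient independent? minB x∉B
    with MatroidProperties.dependent⇒⊇circuit N independent?
           (minimal-basis-lower-part-dependent N minB x∉B)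
  ... | D , D-circuit , D⊆S with x ∈? D
  ...   | no x∉D = contradiction (MatroidProperties.Independent-⊆ N D⊆B (B , proj₁ minB , id))
                                 (proj₁ D-circuit)
    where
    D⊆B : D ⊆ B
    D⊆B y∈D with ∈-lower-part⁻ (D⊆S y∈D)
    ... | inj₁ (y∈B , _) = y∈B
    ... | inj₂ refl      = contradiction y∈D x∉D
  ...   | yes x∈D with quotient D D-circuit x x∈D
  ...     | C , C-circuit , C⊆D , x∈C = C , C-circuit , x∈C , C-below
    where
    C-below : ∀ {y} → y ∈ C → y ≢ x → κ y < κ x
    C-below y∈C y≢x with ∈-lower-part⁻ (D⊆S (C⊆D y∈C))
    ... | inj₁ (_ , y<x) = y<x
    ... | inj₂ y≡x       = contradiction y≡x y≢x

  minimal-bases-⊆ : ∀ M N {A B} → M IsQuotientOf N → Decidable (Independent N) →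
    IsMinimalBasis M A → IsMinimalBasis N B → A ⊆ B
  minimal-bases-⊆ M N {A} {B} quotient independent? minA minB {x} x∈A =
    decidable-stable (x ∈? B) λ x∉B →
      let C , C-circuit , x∈C , C-below = quotient-circuit-below M N quotient independent? minB x∉B
          y , y∈C , y∉A , bA-x+y = MatroidProperties.basis-exchange-into-circuit M
                                     (proj₁ minA) x∈A C-circuit x∈C
          y≢x = λ y≡x → y∉A (subst (_∈ A) (sym y≡x) x∈A)
      in minimal-basis-no-descent M minA x∈A y∉A (C-below y∈C y≢x) bA-x+y

rank-cases : ∀ {n} (i a : Fin n) →
  rank i a + toℕ i ≡ toℕ a ⊎ (toℕ a < toℕ i × rank i a + toℕ i ≡ toℕ a + n)
rank-cases {n} i a with toℕ i ≤ᵇ toℕ a | ℕ.≤ᵇ-reflects-≤ (toℕ i) (toℕ a)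
... | true  | ofʸ i≤a = inj₁ (ℕ.m∸n+n≡m i≤a)
... | false | ofⁿ i≰a =
  inj₂ (ℕ.≰⇒> i≰a , ℕ.m∸n+n≡m (ℕ.≤-trans (ℕ.<⇒≤ (toℕ<n i)) (ℕ.m≤n+m n (toℕ a))))

rank+i%n≡a : ∀ {n} (i a : Fin (suc n)) → (rank i a + toℕ i) % suc n ≡ toℕ a
rank+i%n≡a {n} i a with rank-cases i a
... | inj₁ r+i≡a         = trans (cong (_% suc n) r+i≡a) (m<n⇒m%n≡m (toℕ<n a))
... | inj₂ (_ , r+i≡a+n) = begin
  (rank i a + toℕ i) % suc n ≡⟨ cong (_% suc n) r+i≡a+n ⟩
  (toℕ a + suc n) % suc n    ≡⟨ [m+n]%n≡m%n (toℕ a) (suc n) ⟩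
  toℕ a % suc n              ≡⟨ m<n⇒m%n≡m (toℕ<n a) ⟩
  toℕ a                      ∎
  where open ≡-Reasoning

rank-injective : ∀ {n} (i : Fin n) → Injective _≡_ _≡_ (rank i)
rank-injective {suc n} i {a} {b} ra≡rb = toℕ-injective (begin
  toℕ a                      ≡⟨ rank+i%n≡a i a ⟨
  (rank i a + toℕ i) % suc n ≡⟨ cong (λ r → (r + toℕ i) % suc n) ra≡rb ⟩
  (rank i b + toℕ i) % suc n ≡⟨ rank+i%n≡a i b ⟩
  toℕ b                      ∎)
  where open ≡-Reasoning

rank<n : ∀ {n} (i a : Fin n) → rank i a < n
rank<n {n} i a with rank-cases i a
... | inj₁ r+i≡a = ℕ.≤-<-trans (subst (rank i a ≤_) r+i≡a (ℕ.m≤m+n _ _)) (toℕ<n a)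
... | inj₂ (a<i , r+i≡a+n) = ℕ.+-cancelʳ-< (toℕ i) (rank i a) n (begin-strict
  rank i a + toℕ i ≡⟨ r+i≡a+n ⟩
  toℕ a + n        <⟨ ℕ.+-monoˡ-< n a<i ⟩
  toℕ i + n        ≡⟨ ℕ.+-comm (toℕ i) n ⟩
  n + toℕ i        ∎)
  where open ℕ.≤-Reasoning

corank-injective : ∀ {n} (i : Fin n) → Injective _≡_ _≡_ (λ a → n ∸ rank i a)
corank-injective i {a} {b} eq =
  rank-injective i (ℕ.∸-cancelˡ-≡ (ℕ.<⇒≤ (rank<n i a)) (ℕ.<⇒≤ (rank<n i b)) eq)

∈-cyclicOrder : ∀ {n} (i y : Fin n) → y ∈ₗ cyclicOrder i
∈-cyclicOrder {n} i y
  with ∈-++⁻ (take (toℕ i) (allFin n))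
         (subst (y ∈ₗ_) (sym (take++drop≡id (toℕ i) (allFin n))) (∈-allFin y))
... | inj₁ y∈take = ∈-++⁺ʳ (drop (toℕ i) (allFin n)) y∈take
... | inj₂ y∈drop = ∈-++⁺ˡ y∈drop

module Necklace {n} (i : Fin n) =
  MinimalBases (rank i) (rank-injective i) (cyclicOrder i) (∈-cyclicOrder i)
-- Reversing the order turns ≤ᵢ-greatest bases into minimal ones.
module Conecklace {n} (i : Fin n) =
  MinimalBases (λ a → n ∸ rank i a) (corank-injective i) (cyclicOrder i) (∈-cyclicOrder i)

necklace-entry-minimal : ∀ {n} (M : Matroid n) i {A} →
  IsNecklaceEntry M i A → Necklace.IsMinimalBasis i M A
necklace-entry-minimal _ _ (bA , A-least) = bA , λ B bB t →
  Pointwise⇒length-filter-≤ _ _ ℕ.≤-<-trans (symmetric id (A-least B bB))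

conecklace-entry-minimal : ∀ {n} (M : Matroid n) i {A} →
  IsConecklaceEntry M i A → Conecklace.IsMinimalBasis i M A
conecklace-entry-minimal {n} _ _ (bA , A-greatest) = bA , λ B bB t →
  Pointwise⇒length-filter-≤ _ _ (ℕ.≤-<-trans ∘ ℕ.∸-monoʳ-≤ n) (A-greatest B bB)

proposition5p1 : ∀ {n : ℕ} (M N : Matroid n) → IsPositroid M → IsPositroid N →
    M IsQuotientOf N →
    (∀ (i : Fin n) (Iσ Iπ : Subset n) →
    IsNecklaceEntry M i Iσ → IsNecklaceEntry N i Iπ → Iσ ⊆ Iπ)
    × (∀ (i : Fin n) (Jσ Jπ : Subset n) →
    IsConecklaceEntry M i Jσ → IsConecklaceEntry N i Jπ → Jσ ⊆ Jπ)
proposition5p1 M N _ N-positroid quotient =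
  (λ i _ _ Iσ Iπ → Necklace.minimal-bases-⊆ i M N quotient independent?
                     (necklace-entry-minimal M i Iσ) (necklace-entry-minimal N i Iπ)) ,
  (λ i _ _ Jσ Jπ → Conecklace.minimal-bases-⊆ i M N quotient independent?
                     (conecklace-entry-minimal M i Jσ) (conecklace-entry-minimal N i Jπ))
  where
  independent? : Decidable (Independent N)
  independent? = positroid⇒independent? N N-positroid
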